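{- Let $m, n$ be positive integers with $m \le n$ and let $r$ be an $(m,n)$-ranker. There is a sentence $\varphi_r \in \mathrm{FO}^2_{m,n}[<]$ such that for all $w \in \Sigma^\star$, $w \models \varphi_r$ if and only if $r \in R_{m,n}(w)$, i.e. $r$ is defined on $w$.
   Context: $\Sigma$ is a finite alphabet. A word $w=w_1\cdots w_{|w|}\in\Sigma^\star$ is identified with the structure with universe $\{1,\dots,|w|\}$, linear order $<$, and unary relations $Q_{\mathtt a}=\{i:w_i=\mathtt a\}$, $\mathtt a\in\Sigma$. $\mathrm{FO}^2_n[<]$ is the set of first-order formulas over this vocabulary using only variables $x,y$ (which may be requantified) with quantifier depth at most $n$, and $\mathrm{FO}^2_{m,n}[<]$ is the set of those formulas of $\mathrm{FO}^2_n[<]$ such that any path in their parse tree has at most $m$ blocks of alternating quantifiers. A boundary position is a symbol $d_{\mathtt a}$ with direction $d\in\{\triangleright,\triangleleft\}$ and $\mathtt a\in\Sigma$; $\triangleright_{\mathtt a}(w)=\min\{i\in[1,|w|]: w_i=\mathtt a\}$, $\triangleleft_{\mathtt a}(w)=\max\{i\in[1,|w|]: w_i=\mathtt a\}$, and relative to a position $q$: $\triangleright_{\mathtt a}(w,q)=\min\{i\in[q+1,|w|]: w_i=\mathtt a\}$, $\triangleleft_{\mathtt a}(w,q)=\max\{i\in[1,q-1]: w_i=\mathtt a\}$ (min/max of the empty set undefined). An $n$-ranker $r=(p_1,\dots,p_n)$ is a sequence of $n$ boundary positions with $r(w)=p_1(w)$ if $n=1$, $r(w)$ undefined if $(p_1,\dots,p_{n-1})(w)$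 is undefined, and otherwise $r(w)=p_n(w,(p_1,\dots,p_{n-1})(w))$. An $(m,n)$-ranker is an $n$-ranker whose sequence of directions consists of exactly $m$ maximal blocks of equal direction. $R_{m,n}(w)$ is the set of $(m,n)$-rankers defined on $w$. -}

module Defs where

open import Data.Nat using (ℕ; zero; suc; _+_; _∸_; _≤_; _⊔_)
open import Data.Fin using (Fin; _≟_)
open import Data.Bool using (Bool; true; false; if_then_else_)
open import Data.Maybe using (Maybe; just; nothing; Is-just)
open import Data.List using (List; []; _∷_; length; map; upTo; filterᵇ; head; last)
open import Data.Vec using (Vec; toList)
open import Data.Product using (_×_; ∃; ∃-syntax; _,_)
open import Relation.Nullary.Decidable using (⌊_⌋)
open import Relation.Binary.PropositionalEquality using (_≡_)

Word : ℕ → Set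
Word k = List (Fin k)

-- 1-indexed letter access: at w i = just w_i for 1 ≤ i ≤ |w|, else nothing
at : ∀ {k} → Word k → ℕ → Maybe (Fin k)
at []       _             = nothing
at (x ∷ xs) zero          = nothing
at (x ∷ xs) (suc zero)    = just x
at (x ∷ xs) (suc (suc i)) = at xs (suc i)

hasLetter : ∀ {k} → Word k → Fin k → ℕ → Bool
hasLetter w a i with at w i
... | just b  = ⌊ a ≟ b ⌋
... | nothing = false

-- Formulas are in negation normal form
-- (negation only on atoms); every FO² formula is equivalent to one in
-- NNF with the same quantifier depth and the same quantifier blocks.

data Var : Set where
  vx vy : Var

data Formula (k : ℕ) : Set where
  tt ff    : Formula k
  Q        : Fin k → Var → Formula k
  notQ     : Fin k → Var → Formula k
  lt       : Var → Var → Formula k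
  notLt    : Var → Var → Formula k
  eq       : Var → Var → Formula k
  notEq    : Var → Var → Formula k
  _∧ᶠ_ _∨ᶠ_ : Formula k → Formula k → Formula k
  ex all   : Var → Formula k → Formula k

qd : ∀ {k} → Formula k → ℕ
qd (φ ∧ᶠ ψ) = qd φ ⊔ qd ψ
qd (φ ∨ᶠ ψ) = qd φ ⊔ qd ψ
qd (ex v φ) = suc (qd φ)
qd (all v φ) = suc (qd φ)
qd _ = 0

data QKind : Set where
  E A : QKind

-- number of blocks of alternating quantifiers along a path, given the
-- kind of the last quantifier met so far on that path (if any);
-- the maximum over all paths of the parse tree
blocksFrom : ∀ {k} → Maybe QKind → Formula k → ℕ
blocksFrom c (φ ∧ᶠ ψ) = blocksFrom c φ ⊔ blocksFrom c ψ
blocksFrom c (φ ∨ᶠ ψ) = blocksFrom c φ ⊔ blocksFrom c ψ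
blocksFrom (just E) (ex v φ)  = blocksFrom (just E) φ
blocksFrom _        (ex v φ)  = suc (blocksFrom (just E) φ)
blocksFrom (just A) (all v φ) = blocksFrom (just A) φ
blocksFrom _        (all v φ) = suc (blocksFrom (just A) φ)
blocksFrom _ _ = 0

qblocks : ∀ {k} → Formula k → ℕ
qblocks = blocksFrom nothing

_==ᵛ_ : Var → Var → Bool
vx ==ᵛ vx = true
vy ==ᵛ vy = true
_  ==ᵛ _  = false

_or_ : Bool → Bool → Bool
true  or b = true
false or b = b

free : ∀ {k} → Var → Formula k → Bool
free v tt = false
free v ff = false
free v (Q _ u)    = v ==ᵛ u
free v (notQ _ u) = v ==ᵛ u
free v (lt u u')    = (v ==ᵛ u) or (v ==ᵛ u')
free v (notLt u u') = (v ==ᵛ u) or (v ==ᵛ u')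
free v (eq u u')    = (v ==ᵛ u) or (v ==ᵛ u')
free v (notEq u u') = (v ==ᵛ u) or (v ==ᵛ u')
free v (φ ∧ᶠ ψ) = free v φ or free v ψ
free v (φ ∨ᶠ ψ) = free v φ or free v ψ
free v (ex u φ)  = if v ==ᵛ u then false else free v φ
free v (all u φ) = if v ==ᵛ u then false else free v φ

IsSentence : ∀ {k} → Formula k → Set
IsSentence φ = free vx φ ≡ false × free vy φ ≡ false

InFO2 : ∀ {k} → ℕ → ℕ → Formula k → Set
InFO2 m n φ = qd φ ≤ n × qblocks φ ≤ m

Assignment : Set
Assignment = Var → ℕ

_[_↦_] : Assignment → Var → ℕ → Assignment
(ρ [ vx ↦ i ]) vx = i
(ρ [ vx ↦ i ]) vy = ρ vy
(ρ [ vy ↦ i ]) vx = ρ vx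
(ρ [ vy ↦ i ]) vy = i

Sat : ∀ {k} → Word k → Assignment → Formula k → Set
Sat w ρ tt = ⊤' where open import Data.Unit renaming (⊤ to ⊤')
Sat w ρ ff = ⊥' where open import Data.Empty renaming (⊥ to ⊥')
Sat w ρ (Q a v)    = at w (ρ v) ≡ just a
Sat w ρ (notQ a v) = at w (ρ v) ≡ just a → ⊥' where open import Data.Empty renaming (⊥ to ⊥')
Sat w ρ (lt u v)    = ρ u Data.Nat.< ρ v
Sat w ρ (notLt u v) = ρ u Data.Nat.< ρ v → ⊥' where open import Data.Empty renaming (⊥ to ⊥')
Sat w ρ (eq u v)    = ρ u ≡ ρ v
Sat w ρ (notEq u v) = ρ u ≡ ρ v → ⊥' where open import Data.Empty renaming (⊥ to ⊥')
Sat w ρ (φ ∧ᶠ ψ) = Sat w ρ φ × Sat w ρ ψ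
Sat w ρ (φ ∨ᶠ ψ) = Sat w ρ φ ⊎' Sat w ρ ψ where open import Data.Sum renaming (_⊎_ to _⊎'_)
Sat w ρ (ex v φ)  = ∃[ i ] (1 ≤ i × i ≤ length w × Sat w (ρ [ v ↦ i ]) φ)
Sat w ρ (all v φ) = ∀ i → 1 ≤ i → i ≤ length w → Sat w (ρ [ v ↦ i ]) φ

-- w ⊨ φ for a sentence φ (the assignment is irrelevant for sentences)
_⊨_ : ∀ {k} → Word k → Formula k → Set
w ⊨ φ = Sat w (λ _ → 0) φ

data Dir : Set where
  ▷ ◁ : Dir

record BPos (k : ℕ) : Set where
  constructor bp
  field
    dir    : Dir
    letter : Fin k
open BPos public

-- positions lo, lo+1, …, hi (empty if hi < lo)
interval : ℕ → ℕ → List ℕ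
interval lo hi = map (λ j → lo + j) (upTo (suc hi ∸ lo))

occurrences : ∀ {k} → Word k → Fin k → ℕ → ℕ → List ℕ
occurrences w a lo hi = filterᵇ (hasLetter w a) (interval lo hi)

-- d_a(w): min / max of {i ∈ [1,|w|] : w_i = a}
evalAbs : ∀ {k} → BPos k → Word k → Maybe ℕ
evalAbs (bp ▷ a) w = head (occurrences w a 1 (length w))
evalAbs (bp ◁ a) w = last (occurrences w a 1 (length w))

-- d_a(w,q): min {i ∈ [q+1,|w|] : w_i = a} / max {i ∈ [1,q-1] : w_i = a}
evalRel : ∀ {k} → BPos k → Word k → ℕ → Maybe ℕ
evalRel (bp ▷ a) w q = head (occurrences w a (suc q) (length w))
evalRel (bp ◁ a) w q = last (occurrences w a 1 (q ∸ 1))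

evalRest : ∀ {k} → List (BPos k) → Word k → Maybe ℕ → Maybe ℕ
evalRest ps       w nothing  = nothing
evalRest []       w (just q) = just q
evalRest (p ∷ ps) w (just q) = evalRest ps w (evalRel p w q)

evalRanker : ∀ {k} → List (BPos k) → Word k → Maybe ℕ
evalRanker []       w = nothing
evalRanker (p ∷ ps) w = evalRest ps w (evalAbs p w)

Ranker : ℕ → ℕ → Set
Ranker k n = Vec (BPos k) n

dirBlocksFrom : ∀ {k} → Maybe Dir → List (BPos k) → ℕ
dirBlocksFrom c [] = 0
dirBlocksFrom (just ▷) (bp ▷ a ∷ ps) = dirBlocksFrom (just ▷) ps
dirBlocksFrom (just ◁) (bp ◁ a ∷ ps) = dirBlocksFrom (just ◁) ps
dirBlocksFrom _ (bp d a ∷ ps) = suc (dirBlocksFrom (just d) ps)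

dirBlocks : ∀ {k n} → Ranker k n → ℕ
dirBlocks r = dirBlocksFrom nothing (toList r)

IsMNRanker : ∀ {k} → (m n : ℕ) → Ranker k n → Set
IsMNRanker m n r = dirBlocks r ≡ m

DefinedOn : ∀ {k n} → Ranker k n → Word k → Set
DefinedOn r w = ∃[ i ] (evalRanker (toList r) w ≡ just i)

InR : ∀ {k} → (m n : ℕ) → Ranker k n → Word k → Set
InR m n r w = IsMNRanker m n r × DefinedOn r w

module Submission where

-- Reading r = (p₁,…,pₙ) from left to right, we keep a *state*: FO² formulas describing the
-- current (partial) position q without naming it.  For each reading direction d the state
-- holds a formula  after d v  meaning "q is defined and lies strictly before v when reading
-- in direction d", together with a sentence meaning "q is defined".  Advancing by d_a moves
-- q to q', the nearest a-position beyond q in direction d, and needs only the formulas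
-- after d u :
--   q' before_d v  iff  ∃u. u before_d v ∧ Q_a(u) ∧ after d u,
--   v before_d q'  iff  (q' is defined) ∧ ¬∃u. ¬(v before_d u) ∧ Q_a(u) ∧ after d u.
-- The bound variable u is always the variable other than v, so two variables suffice.
-- Negation is pushed to the atoms by the De Morgan dual, which swaps ∃ and ∀; hence each
-- step adds one to the quantifier depth, and the number of alternation blocks grows only
-- when the reading direction changes.  Then φ_r is the "defined" sentence of the final state.

open import Defs
open import Data.Nat using (ℕ; _≤_)
open import Data.Product using (Σ; _×_)
open import Function.Bundles using (_⇔_)

open import Data.Nat using (zero; suc; _+_; _∸_; _<_; z≤n; s≤s; _⊔_; pred; _<?_; _≟_)
open import Data.Nat.Properties
  using ( ≤-refl; ≤-trans; <-≤-trans; ≤-<-trans; ≮⇒≥; <⇒≱; <-irrefl; <-asym; <⇒≤pred; n≤1+n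
        ; m≤m+n; m≤n⇒m≤1+n; m≤n⇒m≤n+o; m≤n⇒m<n∨m≡n; m+[n∸m]≡n; ∸-monoˡ-<; +-monoʳ-<
        ; +-suc; ⊔-lub; ⊔-mono-≤ )
open import Data.Fin using (Fin) renaming (_≟_ to _≟ᶠ_)
open import Data.Bool using (false; T; if_then_else_)
open import Data.Unit using (tt)
open import Data.Empty using (⊥-elim)
open import Data.Sum using (_⊎_; inj₁; inj₂; swap)
open import Data.Maybe using (Maybe; just; nothing; _>>=_)
import Data.Maybe.Properties as Maybe
open import Data.List using (List; []; _∷_; length; head; last)
open import Data.List.Membership.Propositional using (_∈_)
import Data.List.Membership.Propositional.Properties as ∈
open import Data.List.Relation.Unary.Any using (here; there)
import Data.List.Relation.Unary.All as All
open import Data.List.Relation.Unary.AllPairs using (AllPairs; _∷_)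
import Data.List.Relation.Unary.AllPairs.Properties as AllPairs
open import Data.Vec using (toList; _∷_)
open import Data.Vec.Properties using (length-toList)
open import Data.Product using (_,_; proj₁; proj₂; ∃-syntax)
open import Function using (id; _∘_)
open import Function.Bundles using (Equivalence; mk⇔)
open import Relation.Nullary using (¬_; Dec; yes; no)
open import Relation.Nullary.Decidable using (T?; toWitness; fromWitness; toSum)
open import Relation.Binary.PropositionalEquality using (_≡_; refl; sym; trans; cong; cong₂; subst)

open Equivalence using (to; from)

Before : Dir → ℕ → ℕ → Set
Before ▷ i j = i < j
Before ◁ i j = j < i

flip : Dir → Dir
flip ▷ = ◁
flip ◁ = ▷

flip-flip : ∀ d → flip (flip d) ≡ d
flip-flip ▷ = refl
flip-flip ◁ = refl

before-flip : ∀ d {i j} → Before (flip d) i j ⇔ Before d j i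
before-flip ▷ = mk⇔ id id
before-flip ◁ = mk⇔ id id

before? : ∀ d i j → Dec (Before d i j)
before? ▷ i j = i <? j
before? ◁ i j = j <? i

before-≮-trans : ∀ d {i j k} → Before d i j → ¬ Before d k j → Before d i k
before-≮-trans ▷ i<j k≮j = <-≤-trans i<j (≮⇒≥ k≮j)
before-≮-trans ◁ j<i k≮j = ≤-<-trans (≮⇒≥ k≮j) j<i

≮-before-trans : ∀ d {i j k} → ¬ Before d j i → Before d j k → Before d i k
≮-before-trans ▷ j≮i j<k = ≤-<-trans (≮⇒≥ j≮i) j<k
≮-before-trans ◁ j≮i k<j = <-≤-trans k<j (≮⇒≥ j≮i)

InWord : ∀ {k} → Word k → ℕ → Set
InWord w i = 1 ≤ i × i ≤ length w

IsDefined : Maybe ℕ → Set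
IsDefined mq = ∃[ q ] mq ≡ just q

letter-inWord : ∀ {k} (w : Word k) i {b} → at w i ≡ just b → InWord w i
letter-inWord []       i             ()
letter-inWord (x ∷ xs) zero          ()
letter-inWord (x ∷ xs) (suc zero)    _ = s≤s z≤n , s≤s z≤n
letter-inWord (x ∷ xs) (suc (suc i)) e = s≤s z≤n , s≤s (proj₂ (letter-inWord xs (suc i) e))

offset-bound : ∀ lo t hi → t < suc hi ∸ lo → lo + t ≤ hi
offset-bound zero          t hi      (s≤s t≤hi) = t≤hi
offset-bound (suc zero)    t zero    ()
offset-bound (suc (suc l)) t zero    ()
offset-bound (suc l)       t (suc h) t<        = s≤s (offset-bound l t h t<)

∈-interval⁺ : ∀ {lo j hi} → lo ≤ j → j ≤ hi → j ∈ interval lo hi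
∈-interval⁺ {lo} {hi = hi} lo≤j j≤hi =
  subst (_∈ interval lo hi) (m+[n∸m]≡n lo≤j)
        (∈.∈-map⁺ (lo +_) (∈.∈-upTo⁺ (∸-monoˡ-< (s≤s j≤hi) lo≤j)))

∈-interval⁻ : ∀ {lo j hi} → j ∈ interval lo hi → lo ≤ j × j ≤ hi
∈-interval⁻ {lo} {hi = hi} j∈ with ∈.∈-map⁻ (lo +_) j∈
... | t , t∈ , refl = m≤m+n lo t , offset-bound lo t hi (∈.∈-upTo⁻ t∈)

interval-increasing : ∀ lo hi → AllPairs _<_ (interval lo hi)
interval-increasing lo hi =
  AllPairs.map⁺ (AllPairs.applyUpTo⁺₁ id _ (λ i<j _ → +-monoʳ-< lo i<j))

hasLetter⇔ : ∀ {k} (w : Word k) a i → T (hasLetter w a i) ⇔ (at w i ≡ just a)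
hasLetter⇔ w a i with at w i
... | nothing = mk⇔ (λ ()) (λ ())
... | just b  = mk⇔ (λ t → cong just (sym (toWitness t))) (λ { refl → fromWitness refl })

module _ {k} (w : Word k) (a : Fin k) where

  ∈-occurrences : ∀ {lo j hi} → j ∈ occurrences w a lo hi ⇔ ((lo ≤ j × j ≤ hi) × at w j ≡ just a)
  ∈-occurrences {lo} {j} {hi} = mk⇔ forth back
    where
    forth : j ∈ occurrences w a lo hi → (lo ≤ j × j ≤ hi) × at w j ≡ just a
    forth j∈ with ∈.∈-filter⁻ (T? ∘ hasLetter w a) j∈
    ... | j∈interval , t = ∈-interval⁻ j∈interval , to (hasLetter⇔ w a j) t
    back : (lo ≤ j × j ≤ hi) × at w j ≡ just a → j ∈ occurrences w a lo hi
    back ((lo≤j , j≤hi) , e) =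
      ∈.∈-filter⁺ (T? ∘ hasLetter w a) (∈-interval⁺ lo≤j j≤hi) (from (hasLetter⇔ w a j) e)

  occurrences-increasing : ∀ lo hi → AllPairs _<_ (occurrences w a lo hi)
  occurrences-increasing lo hi = AllPairs.filter⁺ (T? ∘ hasLetter w a) (interval-increasing lo hi)

  Beyond : Dir → ℕ → ℕ → Set
  Beyond d q j = Before d q j × at w j ≡ just a

  window : Dir → ℕ → List ℕ
  window ▷ q = occurrences w a (suc q) (length w)
  window ◁ q = occurrences w a 1 (pred q)

  ∈-window : ∀ d {q j} → j ∈ window d q ⇔ Beyond d q j
  ∈-window ▷ {q} {j} =
    mk⇔ (λ j∈ → let ((q<j , _) , e) = to ∈-occurrences j∈ in q<j , e)
        (λ (q<j , e) → from ∈-occurrences ((q<j , proj₂ (letter-inWord w j e)) , e))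
  ∈-window ◁ {q} {j} =
    mk⇔ (λ j∈ → let ((1≤j , j≤pq) , e) = to ∈-occurrences j∈ in ≤pred⇒< 1≤j j≤pq , e)
        (λ (j<q , e) → from ∈-occurrences ((proj₁ (letter-inWord w j e) , <⇒≤pred j<q) , e))
    where
    ≤pred⇒< : ∀ {j q} → 1 ≤ j → j ≤ pred q → j < q
    ≤pred⇒< {q = suc q} _   j≤q = s≤s j≤q
    ≤pred⇒< {q = zero}  1≤j j≤0 = ⊥-elim (<⇒≱ 1≤j j≤0)

  window-increasing : ∀ d q → AllPairs _<_ (window d q)
  window-increasing ▷ q = occurrences-increasing (suc q) (length w)
  window-increasing ◁ q = occurrences-increasing 1 (pred q)

nearest : Dir → List ℕ → Maybe ℕ
nearest ▷ = head
nearest ◁ = last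

nearest-first : ∀ d {xs i} → AllPairs _<_ xs → nearest d xs ≡ just i →
                i ∈ xs × (∀ {j} → j ∈ xs → ¬ Before d j i)
nearest-first ▷ {x ∷ xs} (x< ∷ _) refl =
  here refl , λ { (here refl) → <-irrefl refl ; (there j∈) → <-asym (All.lookup x< j∈) }
nearest-first ◁ {x ∷ []} _ refl = here refl , λ { (here refl) → <-irrefl refl ; (there ()) }
nearest-first ◁ {x ∷ y ∷ ys} (x< ∷ inc) e with nearest-first ◁ {y ∷ ys} inc e
... | i∈ , maximal = there i∈ , λ { (here refl) → <-asym (All.lookup x< i∈) ; (there j∈) → maximal j∈ }

nearest-defined : ∀ d {xs j} → j ∈ xs → IsDefined (nearest d xs)
nearest-defined ▷ {x ∷ xs}     _ = x , refl
nearest-defined ◁ {x ∷ []}     _ = x , refl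
nearest-defined ◁ {x ∷ y ∷ ys} _ = nearest-defined ◁ {y ∷ ys} (here refl)

module _ {k} (w : Word k) (a : Fin k) where

  evalRel-window : ∀ d q → evalRel (bp d a) w q ≡ nearest d (window w a d q)
  evalRel-window ▷ q = refl
  evalRel-window ◁ q = refl

  evalRel-nearest : ∀ d {q i} → evalRel (bp d a) w q ≡ just i →
                    Beyond w a d q i × (∀ {j} → Beyond w a d q j → ¬ Before d j i)
  evalRel-nearest d {q} e with nearest-first d (window-increasing w a d q) (trans (sym (evalRel-window d q)) e)
  ... | i∈ , first = to (∈-window w a d) i∈ , λ b → first (from (∈-window w a d) b)

  evalRel-defined : ∀ d {q j} → Beyond w a d q j → IsDefined (evalRel (bp d a) w q)
  evalRel-defined d {q} b =
    subst IsDefined (sym (evalRel-window d q)) (nearest-defined d (from (∈-window w a d) b))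

neg : ∀ {k} → Formula k → Formula k
neg tt          = ff
neg ff          = tt
neg (Q a v)     = notQ a v
neg (notQ a v)  = Q a v
neg (lt u v)    = notLt u v
neg (notLt u v) = lt u v
neg (eq u v)    = notEq u v
neg (notEq u v) = eq u v
neg (φ ∧ᶠ ψ)    = neg φ ∨ᶠ neg ψ
neg (φ ∨ᶠ ψ)    = neg φ ∧ᶠ neg ψ
neg (ex v φ)    = all v (neg φ)
neg (all v φ)   = ex v (neg φ)

neg-qd : ∀ {k} (φ : Formula k) → qd (neg φ) ≡ qd φ
neg-qd tt          = refl
neg-qd ff          = refl
neg-qd (Q a v)     = refl
neg-qd (notQ a v)  = refl
neg-qd (lt u v)    = refl
neg-qd (notLt u v) = refl
neg-qd (eq u v)    = refl
neg-qd (notEq u v) = refl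
neg-qd (φ ∧ᶠ ψ)    = cong₂ _⊔_ (neg-qd φ) (neg-qd ψ)
neg-qd (φ ∨ᶠ ψ)    = cong₂ _⊔_ (neg-qd φ) (neg-qd ψ)
neg-qd (ex v φ)    = cong suc (neg-qd φ)
neg-qd (all v φ)   = cong suc (neg-qd φ)

neg-free : ∀ {k} u (φ : Formula k) → free u (neg φ) ≡ free u φ
neg-free u tt          = refl
neg-free u ff          = refl
neg-free u (Q a v)     = refl
neg-free u (notQ a v)  = refl
neg-free u (lt x y)    = refl
neg-free u (notLt x y) = refl
neg-free u (eq x y)    = refl
neg-free u (notEq x y) = refl
neg-free u (φ ∧ᶠ ψ)    = cong₂ _or_ (neg-free u φ) (neg-free u ψ)
neg-free u (φ ∨ᶠ ψ)    = cong₂ _or_ (neg-free u φ) (neg-free u ψ)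
neg-free u (ex v φ)    = cong (if u ==ᵛ v then false else_) (neg-free u φ)
neg-free u (all v φ)   = cong (if u ==ᵛ v then false else_) (neg-free u φ)

blocksE blocksA : ∀ {k} → Formula k → ℕ
blocksE = blocksFrom (just E)
blocksA = blocksFrom (just A)

neg-blocks : ∀ {k} (φ : Formula k) → blocksE (neg φ) ≡ blocksA φ × blocksA (neg φ) ≡ blocksE φ
neg-blocks tt          = refl , refl
neg-blocks ff          = refl , refl
neg-blocks (Q a v)     = refl , refl
neg-blocks (notQ a v)  = refl , refl
neg-blocks (lt u v)    = refl , refl
neg-blocks (notLt u v) = refl , refl
neg-blocks (eq u v)    = refl , refl
neg-blocks (notEq u v) = refl , refl
neg-blocks (φ ∧ᶠ ψ)    = cong₂ _⊔_ (proj₁ (neg-blocks φ)) (proj₁ (neg-blocks ψ))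
                       , cong₂ _⊔_ (proj₂ (neg-blocks φ)) (proj₂ (neg-blocks ψ))
neg-blocks (φ ∨ᶠ ψ)    = cong₂ _⊔_ (proj₁ (neg-blocks φ)) (proj₁ (neg-blocks ψ))
                       , cong₂ _⊔_ (proj₂ (neg-blocks φ)) (proj₂ (neg-blocks ψ))
neg-blocks (ex v φ)    = cong suc (proj₂ (neg-blocks φ)) , proj₂ (neg-blocks φ)
neg-blocks (all v φ)   = proj₁ (neg-blocks φ) , cong suc (proj₁ (neg-blocks φ))

blocks-start : ∀ {k} (φ : Formula k) → qblocks φ ≤ suc (blocksE φ)
blocks-start tt          = z≤n
blocks-start ff          = z≤n
blocks-start (Q a v)     = z≤n
blocks-start (notQ a v)  = z≤n
blocks-start (lt u v)    = z≤n
blocks-start (notLt u v) = z≤n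
blocks-start (eq u v)    = z≤n
blocks-start (notEq u v) = z≤n
blocks-start (φ ∧ᶠ ψ)    = ⊔-mono-≤ (blocks-start φ) (blocks-start ψ)
blocks-start (φ ∨ᶠ ψ)    = ⊔-mono-≤ (blocks-start φ) (blocks-start ψ)
blocks-start (ex v φ)    = ≤-refl
blocks-start (all v φ)   = n≤1+n _

bounded-search : ∀ N {P R : ℕ → Set} → (∀ i → P i ⊎ R i) →
                 (∃[ i ] (1 ≤ i × i ≤ N × P i)) ⊎ (∀ i → 1 ≤ i → i ≤ N → R i)
bounded-search zero    pr = inj₂ λ i 1≤i i≤0 → ⊥-elim (<⇒≱ 1≤i i≤0)
bounded-search (suc N) {R = R} pr with pr (suc N) | bounded-search N pr
... | inj₁ p | _                          = inj₁ (suc N , s≤s z≤n , ≤-refl , p)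
... | inj₂ _ | inj₁ (i , 1≤i , i≤N , p)   = inj₁ (i , 1≤i , m≤n⇒m≤1+n i≤N , p)
... | inj₂ r | inj₂ below                 = inj₂ everywhere
  where
  everywhere : ∀ i → 1 ≤ i → i ≤ suc N → R i
  everywhere i 1≤i i≤1+N with m≤n⇒m<n∨m≡n i≤1+N
  ... | inj₁ (s≤s i≤N) = below i 1≤i i≤N
  ... | inj₂ refl      = r

module _ {k} (w : Word k) where

  neg-sound : ∀ ρ φ → Sat w ρ (neg φ) → ¬ Sat w ρ φ
  neg-sound ρ tt          ()
  neg-sound ρ ff          _ ()
  neg-sound ρ (Q a v)     ¬s s = ¬s s
  neg-sound ρ (notQ a v)  s ¬s = ¬s s
  neg-sound ρ (lt u v)    ¬s s = ¬s s
  neg-sound ρ (notLt u v) s ¬s = ¬s s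
  neg-sound ρ (eq u v)    ¬s s = ¬s s
  neg-sound ρ (notEq u v) s ¬s = ¬s s
  neg-sound ρ (φ ∧ᶠ ψ)    (inj₁ n) (s , _) = neg-sound ρ φ n s
  neg-sound ρ (φ ∧ᶠ ψ)    (inj₂ n) (_ , s) = neg-sound ρ ψ n s
  neg-sound ρ (φ ∨ᶠ ψ)    (n , _) (inj₁ s) = neg-sound ρ φ n s
  neg-sound ρ (φ ∨ᶠ ψ)    (_ , n) (inj₂ s) = neg-sound ρ ψ n s
  neg-sound ρ (ex v φ)    n (i , 1≤i , i≤n , s) = neg-sound (ρ [ v ↦ i ]) φ (n i 1≤i i≤n) s
  neg-sound ρ (all v φ)   (i , 1≤i , i≤n , n) s = neg-sound (ρ [ v ↦ i ]) φ n (s i 1≤i i≤n)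

  -- Every formula or its dual holds: satisfaction in a finite word is decidable.
  sat-or-neg : ∀ ρ φ → Sat w ρ φ ⊎ Sat w ρ (neg φ)
  sat-or-neg ρ tt          = inj₁ tt
  sat-or-neg ρ ff          = inj₂ tt
  sat-or-neg ρ (Q a v)     = toSum (Maybe.≡-dec _≟ᶠ_ (at w (ρ v)) (just a))
  sat-or-neg ρ (notQ a v)  = swap (toSum (Maybe.≡-dec _≟ᶠ_ (at w (ρ v)) (just a)))
  sat-or-neg ρ (lt u v)    = toSum (ρ u <? ρ v)
  sat-or-neg ρ (notLt u v) = swap (toSum (ρ u <? ρ v))
  sat-or-neg ρ (eq u v)    = toSum (ρ u ≟ ρ v)
  sat-or-neg ρ (notEq u v) = swap (toSum (ρ u ≟ ρ v))
  sat-or-neg ρ (φ ∧ᶠ ψ) with sat-or-neg ρ φ | sat-or-neg ρ ψ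
  ... | inj₁ s | inj₁ t = inj₁ (s , t)
  ... | inj₂ n | _      = inj₂ (inj₁ n)
  ... | inj₁ _ | inj₂ n = inj₂ (inj₂ n)
  sat-or-neg ρ (φ ∨ᶠ ψ) with sat-or-neg ρ φ | sat-or-neg ρ ψ
  ... | inj₁ s | _      = inj₁ (inj₁ s)
  ... | inj₂ _ | inj₁ t = inj₁ (inj₂ t)
  ... | inj₂ n | inj₂ m = inj₂ (n , m)
  sat-or-neg ρ (ex v φ)  = bounded-search (length w) (λ i → sat-or-neg (ρ [ v ↦ i ]) φ)
  sat-or-neg ρ (all v φ) = swap (bounded-search (length w) (λ i → swap (sat-or-neg (ρ [ v ↦ i ]) φ)))

  neg-complete : ∀ ρ φ → ¬ Sat w ρ φ → Sat w ρ (neg φ)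
  neg-complete ρ φ ¬s with sat-or-neg ρ φ
  ... | inj₁ s = ⊥-elim (¬s s)
  ... | inj₂ n = n

record State (k : ℕ) : Set where
  field
    after   : Dir → Var → Formula k   -- "q is defined and q is d-before v"
    defined : Formula k
open State

-- The variable that is not v; it is the one quantified in a step.
other : Var → Var
other vx = vy
other vy = vx

beforeF notBeforeF : ∀ {k} → Dir → Var → Var → Formula k
beforeF ▷ u v = lt u v
beforeF ◁ u v = lt v u
notBeforeF ▷ u v = notLt u v
notBeforeF ◁ u v = notLt v u

module _ {k} (d : Dir) (a : Fin k) (s : State k) where

  candidateF : Var → Formula k → Formula k
  candidateF u B = ex u ((B ∧ᶠ Q a u) ∧ᶠ after s d u)

  existsF : Formula k
  existsF = candidateF vx tt

  reachF : Var → Formula k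
  reachF v = candidateF (other v) (beforeF d (other v) v)

  blockF : Var → Formula k
  blockF v = candidateF (other v) (notBeforeF d v (other v))

  -- v is d-before q'
  crossF : Var → Formula k
  crossF v = existsF ∧ᶠ neg (blockF v)

advance : ∀ {k} → BPos k → State k → State k
advance {k} (bp d a) s = record { after = after′ d ; defined = existsF d a s }
  where
  after′ : Dir → Dir → Var → Formula k
  after′ ▷ ▷ = reachF ▷ a s
  after′ ◁ ◁ = reachF ◁ a s
  after′ ▷ ◁ = crossF ▷ a s
  after′ ◁ ▷ = crossF ◁ a s

advance-after : ∀ {k} (P : Dir → Var → Formula k → Set) d a s →
                (∀ v → P d v (reachF d a s v)) → (∀ v → P (flip d) v (crossF d a s v)) →
                ∀ d′ v → P d′ v (after (advance (bp d a) s) d′ v)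
advance-after P ▷ a s reach cross ▷ = reach
advance-after P ▷ a s reach cross ◁ = cross
advance-after P ◁ a s reach cross ◁ = reach
advance-after P ◁ a s reach cross ▷ = cross

-- The state before reading anything in direction d: q is the position just outside the
-- word on the side where reading starts, so every position is d-after it.
initial : ∀ {k} → Dir → State k
initial ▷ = record { after = λ { ▷ _ → tt ; ◁ _ → ff } ; defined = tt }
initial ◁ = record { after = λ { ▷ _ → ff ; ◁ _ → tt } ; defined = tt }

run : ∀ {k} → List (BPos k) → State k → State k
run []       s = s
run (p ∷ ps) s = run ps (advance p s)

rankerFormula : ∀ {k} → List (BPos k) → Formula k
rankerFormula []       = ff
rankerFormula (p ∷ ps) = defined (run (p ∷ ps) (initial (dir p)))

-- Free variables: after d v has only v free, and `defined` is a sentence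

record Closed {k} (s : State k) : Set where
  field
    after-closed   : ∀ d v → free (other v) (after s d v) ≡ false
    defined-closed : ∀ u → free u (defined s) ≡ false
open Closed

module _ {k} (d : Dir) (a : Fin k) {s : State k} (c : Closed s) where

  existsF-closed : ∀ u → free u (existsF d a s) ≡ false
  existsF-closed vx = refl
  existsF-closed vy = after-closed c d vx

  candidateF-binds : ∀ u B → free u (candidateF d a s u B) ≡ false
  candidateF-binds vx B = refl
  candidateF-binds vy B = refl

  reachF-closed : ∀ v → free (other v) (reachF d a s v) ≡ false
  reachF-closed v = candidateF-binds (other v) (beforeF d (other v) v)

  crossF-closed : ∀ v → free (other v) (crossF d a s v) ≡ false
  crossF-closed v = cong₂ _or_ (existsF-closed (other v))
                               (trans (neg-free (other v) (blockF d a s v))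
                                      (candidateF-binds (other v) (notBeforeF d v (other v))))

advance-closed : ∀ {k} p {s : State k} → Closed s → Closed (advance p s)
advance-closed (bp d a) {s} c = record
  { after-closed   = advance-after (λ _ v φ → free (other v) φ ≡ false) d a s
                       (reachF-closed d a c) (crossF-closed d a c)
  ; defined-closed = existsF-closed d a c
  }

initial-closed : ∀ {k} d → Closed (initial {k} d)
initial-closed ▷ = record { after-closed = λ { ▷ _ → refl ; ◁ _ → refl } ; defined-closed = λ _ → refl }
initial-closed ◁ = record { after-closed = λ { ▷ _ → refl ; ◁ _ → refl } ; defined-closed = λ _ → refl }

run-closed : ∀ {k} ps {s : State k} → Closed s → Closed (run ps s)
run-closed []       c = c
run-closed (p ∷ ps) c = run-closed ps (advance-closed p c)

-- Quantifier depth: each step adds one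

-- B is quantifier-free: it fits under every bound on depth and on alternation blocks.
QuantifierFree : ∀ {k} → Formula k → Set
QuantifierFree B = ∀ {j} → qd B ≤ j × blocksE B ≤ j

beforeF-qf : ∀ {k} d u v → QuantifierFree (beforeF {k} d u v)
beforeF-qf ▷ u v = z≤n , z≤n
beforeF-qf ◁ u v = z≤n , z≤n

notBeforeF-qf : ∀ {k} d u v → QuantifierFree (notBeforeF {k} d u v)
notBeforeF-qf ▷ u v = z≤n , z≤n
notBeforeF-qf ◁ u v = z≤n , z≤n

record DepthBound {k} (j : ℕ) (s : State k) : Set where
  field
    after-depth   : ∀ d v → qd (after s d v) ≤ j
    defined-depth : qd (defined s) ≤ j
open DepthBound

module _ {k j} (d : Dir) (a : Fin k) {s : State k} (b : DepthBound j s) where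

  candidate-depth : ∀ u B → QuantifierFree B → qd (candidateF d a s u B) ≤ suc j
  candidate-depth u B qf = s≤s (⊔-lub (⊔-lub (proj₁ qf) z≤n) (after-depth b d u))

  existsF-depth : qd (existsF d a s) ≤ suc j
  existsF-depth = candidate-depth vx tt (z≤n , z≤n)

  reachF-depth : ∀ v → qd (reachF d a s v) ≤ suc j
  reachF-depth v = candidate-depth (other v) (beforeF d (other v) v) (beforeF-qf d (other v) v)

  crossF-depth : ∀ v → qd (crossF d a s v) ≤ suc j
  crossF-depth v = ⊔-lub existsF-depth
    (subst (_≤ suc j) (sym (neg-qd (blockF d a s v)))
           (candidate-depth (other v) (notBeforeF d v (other v)) (notBeforeF-qf d v (other v))))

advance-depth : ∀ {k j} p {s : State k} → DepthBound j s → DepthBound (suc j) (advance p s)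
advance-depth {j = j} (bp d a) {s} b = record
  { after-depth   = advance-after (λ _ _ φ → qd φ ≤ suc j) d a s (reachF-depth d a b) (crossF-depth d a b)
  ; defined-depth = existsF-depth d a b
  }

initial-depth : ∀ {k} d → DepthBound 0 (initial {k} d)
initial-depth ▷ = record { after-depth = λ { ▷ _ → z≤n ; ◁ _ → z≤n } ; defined-depth = z≤n }
initial-depth ◁ = record { after-depth = λ { ▷ _ → z≤n ; ◁ _ → z≤n } ; defined-depth = z≤n }

run-depth : ∀ {k j} ps {s : State k} → DepthBound j s → qd (defined (run ps s)) ≤ j + length ps
run-depth {j = j} []       b = m≤n⇒m≤n+o 0 (defined-depth b)
run-depth {j = j} (p ∷ ps) {s} b =
  subst (qd (defined (run ps (advance p s))) ≤_) (sym (+-suc j (length ps))) (run-depth ps (advance-depth p b))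

-- Alternation blocks: a new block only when the reading direction changes

-- While reading in direction d with c blocks so far, the d-formulas and `defined` are
-- existential-led within c blocks; the formulas for the other direction need one more.
record BlockBound {k} (c : ℕ) (d : Dir) (s : State k) : Set where
  field
    forward-blocks  : ∀ v → blocksE (after s d v) ≤ c
    backward-blocks : ∀ v → blocksE (after s (flip d) v) ≤ suc c
    defined-blocks  : blocksE (defined s) ≤ c
open BlockBound

module _ {k c} (d : Dir) (a : Fin k) {s : State k} (b : BlockBound c d s) where

  candidate-blocks : ∀ u B → QuantifierFree B → blocksE (candidateF d a s u B) ≤ c
  candidate-blocks u B qf = ⊔-lub (⊔-lub (proj₂ qf) z≤n) (forward-blocks b u)

  existsF-blocks : blocksE (existsF d a s) ≤ c
  existsF-blocks = candidate-blocks vx tt (z≤n , z≤n)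

  reachF-blocks : ∀ v → blocksE (reachF d a s v) ≤ c
  reachF-blocks v = candidate-blocks (other v) (beforeF d (other v) v) (beforeF-qf d (other v) v)

  -- the dual of an existential-led formula is universal-led: one more block
  crossF-blocks : ∀ v → blocksE (crossF d a s v) ≤ suc c
  crossF-blocks v = ⊔-lub (≤-trans existsF-blocks (n≤1+n c))
    (subst (_≤ suc c) (sym (proj₁ (neg-blocks (blockF d a s v))))
           (s≤s (candidate-blocks (other v) (notBeforeF d v (other v)) (notBeforeF-qf d v (other v)))))

advance-blocks : ∀ {k c} d a {s : State k} → BlockBound c d s → BlockBound c d (advance (bp d a) s)
advance-blocks ▷ a b = record
  { forward-blocks  = reachF-blocks ▷ a b
  ; backward-blocks = crossF-blocks ▷ a b
  ; defined-blocks  = existsF-blocks ▷ a b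
  }
advance-blocks ◁ a b = record
  { forward-blocks  = reachF-blocks ◁ a b
  ; backward-blocks = crossF-blocks ◁ a b
  ; defined-blocks  = existsF-blocks ◁ a b
  }

turn-blocks : ∀ {k c} d {s : State k} → BlockBound c d s → BlockBound (suc c) (flip d) s
turn-blocks {c = c} d {s} b = record
  { forward-blocks  = backward-blocks b
  ; backward-blocks = λ v → subst (λ d′ → blocksE (after s d′ v) ≤ suc (suc c)) (sym (flip-flip d))
                                  (≤-trans (forward-blocks b v) (≤-trans (n≤1+n c) (n≤1+n (suc c))))
  ; defined-blocks  = ≤-trans (defined-blocks b) (n≤1+n c)
  }

initial-blocks : ∀ {k} d → BlockBound 0 d (initial {k} d)
initial-blocks ▷ = record { forward-blocks = λ _ → z≤n ; backward-blocks = λ _ → z≤n ; defined-blocks = z≤n }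
initial-blocks ◁ = record { forward-blocks = λ _ → z≤n ; backward-blocks = λ _ → z≤n ; defined-blocks = z≤n }

run-blocks : ∀ {k c} d ps {s : State k} → BlockBound c d s →
             blocksE (defined (run ps s)) ≤ c + dirBlocksFrom (just d) ps
run-blocks d [] b = m≤n⇒m≤n+o 0 (defined-blocks b)
run-blocks ▷ (bp ▷ a ∷ ps) b = run-blocks ▷ ps (advance-blocks ▷ a b)
run-blocks ◁ (bp ◁ a ∷ ps) b = run-blocks ◁ ps (advance-blocks ◁ a b)
run-blocks {c = c} ▷ (bp ◁ a ∷ ps) {s} b =
  subst (blocksE (defined (run ps (advance (bp ◁ a) s))) ≤_) (sym (+-suc c _))
        (run-blocks ◁ ps (advance-blocks ◁ a (turn-blocks ▷ b)))
run-blocks {c = c} ◁ (bp ▷ a ∷ ps) {s} b =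
  subst (blocksE (defined (run ps (advance (bp ▷ a) s))) ≤_) (sym (+-suc c _))
        (run-blocks ▷ ps (advance-blocks ▷ a (turn-blocks ◁ b)))

-- Semantics: the state describes the current position

After : Maybe ℕ → Dir → ℕ → Set
After mq d j = ∃[ q ] (mq ≡ just q × Before d q j)

-- The state s describes the partial position mq on w (checked at positions of w).
record Represents {k} (w : Word k) (s : State k) (mq : Maybe ℕ) : Set where
  field
    after-sat   : ∀ d v ρ → InWord w (ρ v) → Sat w ρ (after s d v) ⇔ After mq d (ρ v)
    defined-sat : ∀ ρ → Sat w ρ (defined s) ⇔ IsDefined mq
open Represents

upd-same : ∀ ρ u (i : ℕ) → (ρ [ u ↦ i ]) u ≡ i
upd-same ρ vx i = refl
upd-same ρ vy i = refl

module _ {k} (w : Word k) where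

  sat-beforeF : ∀ d v ρ i → Sat w (ρ [ other v ↦ i ]) (beforeF d (other v) v) ⇔ Before d i (ρ v)
  sat-beforeF ▷ vx ρ i = mk⇔ id id
  sat-beforeF ▷ vy ρ i = mk⇔ id id
  sat-beforeF ◁ vx ρ i = mk⇔ id id
  sat-beforeF ◁ vy ρ i = mk⇔ id id

  sat-notBeforeF : ∀ d v ρ i → Sat w (ρ [ other v ↦ i ]) (notBeforeF d v (other v)) ⇔ (¬ Before d (ρ v) i)
  sat-notBeforeF ▷ vx ρ i = mk⇔ id id
  sat-notBeforeF ▷ vy ρ i = mk⇔ id id
  sat-notBeforeF ◁ vx ρ i = mk⇔ id id
  sat-notBeforeF ◁ vy ρ i = mk⇔ id id

module _ {k} (w : Word k) (d : Dir) (a : Fin k) where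

  Candidate : Maybe ℕ → ℕ → Set
  Candidate mq i = After mq d i × at w i ≡ just a

  next-nearest : ∀ {mq i} → (mq >>= evalRel (bp d a) w) ≡ just i →
                 Candidate mq i × (∀ {j} → Candidate mq j → ¬ Before d j i)
  next-nearest {just q} e with evalRel-nearest w a d e
  ... | (q<i , l) , nearest = ((q , refl , q<i) , l) , λ { ((_ , refl , q<j) , l′) → nearest (q<j , l′) }

  next-defined : ∀ {mq j} → Candidate mq j → IsDefined (mq >>= evalRel (bp d a) w)
  next-defined ((q , refl , q<j) , l) = evalRel-defined w a d (q<j , l)

module Step {k} (w : Word k) (d : Dir) (a : Fin k) {s : State k} {mq : Maybe ℕ} (rep : Represents w s mq) where

  mq′ : Maybe ℕ
  mq′ = mq >>= evalRel (bp d a) w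

  candidateF-sat : ∀ ρ u B → Sat w ρ (candidateF d a s u B) ⇔
                             (∃[ i ] (Sat w (ρ [ u ↦ i ]) B × Candidate w d a mq i))
  candidateF-sat ρ u B = mk⇔ forth back
    where
    HasA : ℕ → Set
    HasA i = at w i ≡ just a
    after-at : ∀ i → InWord w i → Sat w (ρ [ u ↦ i ]) (after s d u) ⇔ After mq d i
    after-at i inWord =
      subst (λ j → Sat w (ρ [ u ↦ i ]) (after s d u) ⇔ After mq d j) (upd-same ρ u i)
            (after-sat rep d u (ρ [ u ↦ i ]) (subst (InWord w) (sym (upd-same ρ u i)) inWord))
    forth : Sat w ρ (candidateF d a s u B) → ∃[ i ] (Sat w (ρ [ u ↦ i ]) B × Candidate w d a mq i)
    forth (i , 1≤i , i≤n , (sB , l) , sA) =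
      i , sB , to (after-at i (1≤i , i≤n)) sA , subst HasA (upd-same ρ u i) l
    back : ∃[ i ] (Sat w (ρ [ u ↦ i ]) B × Candidate w d a mq i) → Sat w ρ (candidateF d a s u B)
    back (i , sB , aft , l) with letter-inWord w i l
    ... | inWord@(1≤i , i≤n) =
      i , 1≤i , i≤n , (sB , subst HasA (sym (upd-same ρ u i)) l) , from (after-at i inWord) aft

  existsF-sat : ∀ ρ → Sat w ρ (existsF d a s) ⇔ IsDefined mq′
  existsF-sat ρ = mk⇔
    (λ sat → let (_ , _ , cand) = to (candidateF-sat ρ vx tt) sat in next-defined w d a cand)
    (λ (i , e) → from (candidateF-sat ρ vx tt) (i , tt , proj₁ (next-nearest w d a e)))

  reachF-sat : ∀ v ρ → Sat w ρ (reachF d a s v) ⇔ After mq′ d (ρ v)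
  reachF-sat v ρ = mk⇔ forth back
    where
    guard : Formula k
    guard = beforeF d (other v) v
    forth : Sat w ρ (reachF d a s v) → After mq′ d (ρ v)
    forth sat with to (candidateF-sat ρ (other v) guard) sat
    ... | i , g , cand with next-defined w d a cand
    ...   | i′ , e =
      i′ , e , ≮-before-trans d (proj₂ (next-nearest w d a e) cand) (to (sat-beforeF w d v ρ i) g)
    back : After mq′ d (ρ v) → Sat w ρ (reachF d a s v)
    back (i′ , e , i′<v) =
      from (candidateF-sat ρ (other v) guard)
           (i′ , from (sat-beforeF w d v ρ i′) i′<v , proj₁ (next-nearest w d a e))

  crossF-sat : ∀ v ρ → Sat w ρ (crossF d a s v) ⇔ After mq′ (flip d) (ρ v)
  crossF-sat v ρ = mk⇔ forth back
    where
    guard : Formula k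
    guard = notBeforeF d v (other v)
    blocked : ∀ i′ → Candidate w d a mq i′ → ¬ Before d (ρ v) i′ → Sat w ρ (blockF d a s v)
    blocked i′ cand v≮i′ =
      from (candidateF-sat ρ (other v) guard) (i′ , from (sat-notBeforeF w d v ρ i′) v≮i′ , cand)
    forth : Sat w ρ (crossF d a s v) → After mq′ (flip d) (ρ v)
    forth (sat , unblocked) with to (existsF-sat ρ) sat
    ... | i′ , e with before? d (ρ v) i′
    ...   | yes v<i′ = i′ , e , from (before-flip d) v<i′
    ...   | no v≮i′  =
      ⊥-elim (neg-sound w ρ (blockF d a s v) unblocked (blocked i′ (proj₁ (next-nearest w d a e)) v≮i′))
    back : After mq′ (flip d) (ρ v) → Sat w ρ (crossF d a s v)
    back (i′ , e , flipped) = from (existsF-sat ρ) (i′ , e) , neg-complete w ρ (blockF d a s v) unblocked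
      where
      unblocked : ¬ Sat w ρ (blockF d a s v)
      unblocked sat with to (candidateF-sat ρ (other v) guard) sat
      ... | j , g , cand =
        to (sat-notBeforeF w d v ρ j) g
           (before-≮-trans d (to (before-flip d) flipped) (proj₂ (next-nearest w d a e) cand))

advance-represents : ∀ {k} (w : Word k) p {s mq} → Represents w s mq →
                     Represents w (advance p s) (mq >>= evalRel p w)
advance-represents w (bp d a) {s} rep = record
  { after-sat   = advance-after (λ d′ v φ → ∀ ρ → InWord w (ρ v) → Sat w ρ φ ⇔ After mq′ d′ (ρ v))
                                d a s
                    (λ v ρ _ → reachF-sat v ρ) (λ v ρ _ → crossF-sat v ρ)
  ; defined-sat = existsF-sat
  }
  where open Step w d a rep

origin : ∀ {k} → Dir → Word k → ℕ
origin ▷ w = 0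
origin ◁ w = suc (length w)

initial-represents : ∀ {k} (w : Word k) d → Represents w (initial d) (just (origin d w))
initial-represents w ▷ = record
  { after-sat   = λ { ▷ v ρ (1≤ , _) → mk⇔ (λ _ → 0 , refl , 1≤) (λ _ → tt)
                    ; ◁ v ρ _        → mk⇔ (λ ()) (λ { (_ , refl , ()) }) }
  ; defined-sat = λ ρ → mk⇔ (λ _ → 0 , refl) (λ _ → tt) }
initial-represents w ◁ = record
  { after-sat   = λ { ◁ v ρ (_ , ≤n) → mk⇔ (λ _ → suc (length w) , refl , s≤s ≤n) (λ _ → tt)
                    ; ▷ v ρ (_ , ≤n) → mk⇔ (λ ())
                                           (λ { (_ , refl , n<) → <⇒≱ n< (≤-trans ≤n (n≤1+n (length w))) }) }
  ; defined-sat = λ ρ → mk⇔ (λ _ → suc (length w) , refl) (λ _ → tt) }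

evalRest-undefined : ∀ {k} (w : Word k) ps → evalRest ps w nothing ≡ nothing
evalRest-undefined w []       = refl
evalRest-undefined w (p ∷ ps) = refl

evalRest-step : ∀ {k} (w : Word k) p ps mq → evalRest ps w (mq >>= evalRel p w) ≡ evalRest (p ∷ ps) w mq
evalRest-step w p ps nothing  = evalRest-undefined w ps
evalRest-step w p ps (just q) = refl

run-represents : ∀ {k} (w : Word k) ps {s mq} → Represents w s mq → Represents w (run ps s) (evalRest ps w mq)
run-represents w []       {mq = nothing} rep = rep
run-represents w []       {mq = just q}  rep = rep
run-represents w (p ∷ ps) {s} {mq} rep =
  subst (Represents w (run ps (advance p s))) (evalRest-step w p ps mq)
        (run-represents w ps (advance-represents w p rep))

evalRanker-origin : ∀ {k} (w : Word k) p ps →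
                    evalRest (p ∷ ps) w (just (origin (dir p) w)) ≡ evalRanker (p ∷ ps) w
evalRanker-origin w (bp ▷ a) ps = refl
evalRanker-origin w (bp ◁ a) ps = refl

rankerFormula-sentence : ∀ {k} (p : BPos k) ps → IsSentence (rankerFormula (p ∷ ps))
rankerFormula-sentence p ps = defined-closed closed vx , defined-closed closed vy
  where
  closed : Closed (run (p ∷ ps) (initial (dir p)))
  closed = run-closed (p ∷ ps) (initial-closed (dir p))

rankerFormula-depth : ∀ {k} (p : BPos k) ps → qd (rankerFormula (p ∷ ps)) ≤ suc (length ps)
rankerFormula-depth p ps = run-depth (p ∷ ps) (initial-depth (dir p))

rankerFormula-blocks : ∀ {k} (p : BPos k) ps →
                       qblocks (rankerFormula (p ∷ ps)) ≤ dirBlocksFrom nothing (p ∷ ps)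
rankerFormula-blocks (bp ▷ a) ps =
  ≤-trans (blocks-start (rankerFormula (bp ▷ a ∷ ps)))
          (s≤s (run-blocks ▷ (bp ▷ a ∷ ps) (initial-blocks ▷)))
rankerFormula-blocks (bp ◁ a) ps =
  ≤-trans (blocks-start (rankerFormula (bp ◁ a ∷ ps)))
          (s≤s (run-blocks ◁ (bp ◁ a ∷ ps) (initial-blocks ◁)))

rankerFormula-sat : ∀ {k} (w : Word k) p ps →
                    (w ⊨ rankerFormula (p ∷ ps)) ⇔ IsDefined (evalRanker (p ∷ ps) w)
rankerFormula-sat w p ps =
  subst (λ mq → (w ⊨ rankerFormula (p ∷ ps)) ⇔ IsDefined mq) (evalRanker-origin w p ps)
        (defined-sat (run-represents w (p ∷ ps) (initial-represents w (dir p))) (λ _ → 0))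

lemma4p3 : (k m n : ℕ) → 1 ≤ m → m ≤ n → (r : Ranker k n) → IsMNRanker m n r →
    Σ (Formula k) (λ φ → IsSentence φ × InFO2 m n φ × ((w : Word k) → (w ⊨ φ) ⇔ InR m n r w))
lemma4p3 k (suc m) zero (s≤s _) () _ _
lemma4p3 k m (suc n) _ _ (p ∷ ps) blocks≡m =
  φ , rankerFormula-sentence p (toList ps) , (depth , blocks) , semantics
  where
  φ : Formula k
  φ = rankerFormula (p ∷ toList ps)
  depth : qd φ ≤ suc n
  depth = subst (λ ℓ → qd φ ≤ suc ℓ) (length-toList ps) (rankerFormula-depth p (toList ps))
  blocks : qblocks φ ≤ m
  blocks = subst (qblocks φ ≤_) blocks≡m (rankerFormula-blocks p (toList ps))
  semantics : (w : Word k) → (w ⊨ φ) ⇔ InR m (suc n) (p ∷ ps) w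
  semantics w = mk⇔ (λ sat → blocks≡m , to (rankerFormula-sat w p (toList ps)) sat)
                    (λ (_ , defined) → from (rankerFormula-sat w p (toList ps)) defined)
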